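{- Let $G=(V,E)$ be a König–Egerváry graph. Then: (i) every maximum stable set $S$ of $G$ contains exactly one endpoint of each $\mu$-critical edge; (ii) every maximum stable set $S$ of $G$ contains exactly one endpoint of each $\alpha$-critical edge; (iii) if $G$ has a maximal matching consisting only of $\alpha$-critical edges, then this matching is the unique perfect matching of $G$.
   Context: All graphs are finite and simple; "graph" means a connected graph with at least one edge. $\alpha(G)$ is the stability number, $\mu(G)$ the maximum matching size, $n(G)=|V(G)|$; $G$ is König–Egerváry if $\alpha(G)+\mu(G)=n(G)$. An edge $e$ is $\alpha$-critical if $\alpha(G-e)>\alpha(G)$ and $\mu$-critical if $\mu(G-e)<\mu(G)$, where $G-e$ is $G$ with $e$ deleted. A maximal matching is one not properly contained in another matching. -}

module Defs where

open import Data.Nat using (ℕ; _+_; _≤_; _<_)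
open import Data.Bool using (Bool; true; false; _∧_; _∨_; not; T)
open import Data.Bool.Properties using (∧-comm; ∨-comm)
open import Data.Fin using (Fin; _≟_)
open import Data.Fin.Subset using (Subset; _∈_; _∉_; ∣_∣)
open import Data.List using (List; []; _∷_; length; concatMap)
open import Data.List.Relation.Unary.All using (All)
open import Data.List.Relation.Unary.Any using (Any)
open import Data.List.Relation.Unary.Unique.Propositional using (Unique)
import Data.List.Membership.Propositional as LM
open import Data.Product using (Σ; ∃; ∃-syntax; _×_; _,_)
open import Data.Sum using (_⊎_)
open import Relation.Nullary using (¬_)
open import Relation.Nullary.Decidable using (⌊_⌋)
open import Relation.Binary.PropositionalEquality using (_≡_; refl; cong₂)
open import Relation.Binary.Construct.Closure.ReflexiveTransitive using (Star)

record SimpleGraph (n : ℕ) : Set where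
  field
    adj    : Fin n → Fin n → Bool
    sym    : ∀ u v → adj u v ≡ adj v u
    irrefl : ∀ u → adj u u ≡ false

open SimpleGraph public

Edge : ∀ {n} → SimpleGraph n → Fin n → Fin n → Set
Edge G u v = T (adj G u v)

-- "graph" in the paper: connected with at least one edge
Connected : ∀ {n} → SimpleGraph n → Set
Connected G = ∀ u v → Star (Edge G) u v

IsGraph : ∀ {n} → SimpleGraph n → Set
IsGraph G = Connected G × (∃[ u ] ∃[ v ] Edge G u v)

isEdgeAB : ∀ {n} → Fin n → Fin n → Fin n → Fin n → Bool
isEdgeAB a b u v = (⌊ u ≟ a ⌋ ∧ ⌊ v ≟ b ⌋) ∨ (⌊ u ≟ b ⌋ ∧ ⌊ v ≟ a ⌋)

private
  isEdgeAB-sym : ∀ {n} (a b u v : Fin n) → isEdgeAB a b u v ≡ isEdgeAB a b v u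
  isEdgeAB-sym a b u v
    rewrite ∧-comm ⌊ u ≟ a ⌋ ⌊ v ≟ b ⌋ | ∧-comm ⌊ u ≟ b ⌋ ⌊ v ≟ a ⌋
    = ∨-comm (⌊ v ≟ b ⌋ ∧ ⌊ u ≟ a ⌋) (⌊ v ≟ a ⌋ ∧ ⌊ u ≟ b ⌋)

_─_ : ∀ {n} → SimpleGraph n → Fin n × Fin n → SimpleGraph n
adj    (G ─ (a , b)) u v = adj G u v ∧ not (isEdgeAB a b u v)
sym    (G ─ (a , b)) u v = cong₂ (λ x y → x ∧ not y) (sym G u v) (isEdgeAB-sym a b u v)
irrefl (G ─ (a , b)) u rewrite irrefl G u = refl

Stable : ∀ {n} → SimpleGraph n → Subset n → Set
Stable G S = ∀ u v → u ∈ S → v ∈ S → ¬ Edge G u v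

MaxStable : ∀ {n} → SimpleGraph n → Subset n → Set
MaxStable G S = Stable G S × (∀ T → Stable G T → ∣ T ∣ ≤ ∣ S ∣)

IsAlpha : ∀ {n} → SimpleGraph n → ℕ → Set
IsAlpha G k = ∃[ S ] (MaxStable G S × ∣ S ∣ ≡ k)

endpoints : ∀ {n} → List (Fin n × Fin n) → List (Fin n)
endpoints = concatMap (λ { (u , v) → u ∷ v ∷ [] })

IsMatching : ∀ {n} → SimpleGraph n → List (Fin n × Fin n) → Set
IsMatching G M = All (λ { (u , v) → Edge G u v }) M × Unique (endpoints M)

IsMu : ∀ {n} → SimpleGraph n → ℕ → Set
IsMu G k = ∃[ M ] (IsMatching G M × length M ≡ k
                   × (∀ M′ → IsMatching G M′ → length M′ ≤ k))

IsMaximalMatching : ∀ {n} → SimpleGraph n → List (Fin n × Fin n) → Set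
IsMaximalMatching G M = IsMatching G M × (∀ u v → Edge G u v → ¬ IsMatching G ((u , v) ∷ M))

IsPerfectMatching : ∀ {n} → SimpleGraph n → List (Fin n × Fin n) → Set
IsPerfectMatching G M = IsMatching G M × (∀ w → w LM.∈ endpoints M)

EdgeIn : ∀ {n} → List (Fin n × Fin n) → Fin n → Fin n → Set
EdgeIn M u v = Any (λ p → p ≡ (u , v) ⊎ p ≡ (v , u)) M

SameEdges : ∀ {n} → List (Fin n × Fin n) → List (Fin n × Fin n) → Set
SameEdges M M′ = ∀ u v → (EdgeIn M u v → EdgeIn M′ u v) × (EdgeIn M′ u v → EdgeIn M u v)

IsUniquePerfectMatching : ∀ {n} → SimpleGraph n → List (Fin n × Fin n) → Set
IsUniquePerfectMatching G M =
  IsPerfectMatching G M × (∀ M′ → IsPerfectMatching G M′ → SameEdges M M′)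

KonigEgervary : ∀ {n} → SimpleGraph n → Set
KonigEgervary {n} G = ∃[ a ] ∃[ m ] (IsAlpha G a × IsMu G m × a + m ≡ n)

AlphaCritical : ∀ {n} → SimpleGraph n → Fin n → Fin n → Set
AlphaCritical G u v = Edge G u v ×
  (∃[ a ] ∃[ a′ ] (IsAlpha G a × IsAlpha (G ─ (u , v)) a′ × a < a′))

MuCritical : ∀ {n} → SimpleGraph n → Fin n → Fin n → Set
MuCritical G u v = Edge G u v ×
  (∃[ m ] ∃[ m′ ] (IsMu G m × IsMu (G ─ (u , v)) m′ × m′ < m))

ExactlyOneEndpoint : ∀ {n} → Subset n → Fin n → Fin n → Set
ExactlyOneEndpoint S u v = (u ∈ S × v ∉ S) ⊎ (u ∉ S × v ∈ S)

{-# OPTIONS --safe #-}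
-- Every edge of a matching N has an endpoint outside a stable set S, and these endpoints are
-- distinct, so |N| + |S| ≤ n; in a König–Egerváry graph a maximum matching and a maximum stable
-- set reach this bound, leaving room neither for a larger stable set nor for one more vertex
-- outside S. So a μ-critical edge e lies in every maximum matching (else μ(G - e) = μ), and so
-- does an α-critical e (else a maximum matching of G sits in G - e beside a stable set of size
-- α + 1); an edge of a maximum matching with no endpoint in S, or with both, is impossible.
-- For (iii), maximality of M and the fact that its edges lie in every maximum matching give
-- every maximum (in particular every perfect) matching exactly the edges of M. A vertex w missed
-- by M is then missed by a maximum matching and so lies in every maximum stable set; yet its
-- neighbour x is covered by an α-critical xy ∈ M, and deleting y from a stable set of G - xy of
-- size α + 1 leaves a maximum stable set containing x.
module Submission where

open import Defs
open import Data.Nat using (ℕ; suc; _+_; _*_; _≤_; _<_; z≤n; s≤s; _≤?_)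
open import Data.Nat.Properties
  using ( ≤-refl; ≤-reflexive; ≤-trans; ≤-pred; <⇒≱; ≰⇒>; n≮n; n≤1+n
        ; +-comm; +-suc; +-mono-≤; +-monoˡ-≤; +-monoʳ-≤; +-monoʳ-<
        ; *-distribˡ-+; *-cancelˡ-≤; m≤o∸n⇒m+n≤o; module ≤-Reasoning )
open import Data.Bool using (T; true; false; _∧_)
open import Data.Bool.Properties using (∧-identityʳ)
open import Data.Unit using (tt)
open import Data.Empty using (⊥-elim)
open import Data.Fin using (Fin; _≟_)
open import Data.Fin.Properties using (pigeonhole; <⇒≢)
open import Data.Fin.Subset
  using (Subset; inside; outside; ⁅_⁆; _∪_; _-_; ∁; ⊤; ∣_∣; _∈_; _∉_; _⊆_)
open import Data.Fin.Subset.Properties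
  using ( _∈?_; ∈⊤; ∣⊤∣≡n; ∣p∣≤n; ∣∁p∣≡n∸∣p∣; x∉p⇒x∈∁p; ∣p∣≤∣x∷p∣; ∣⁅x⁆∣≡1; x∈⁅x⁆
        ; x∈p∪q⁺; p⊆q⇒∣p∣≤∣q∣; p─q⊆p; p─q─q≡p─q; x∈p∧x≢y⇒x∈p-y; x∈p⇒∣p-x∣<∣p∣ )
open import Data.Vec using ([]; _∷_)
open import Data.List using (List; []; _∷_; length; filter; lookup)
open import Data.List.Relation.Unary.All as All using (All; []; _∷_)
open import Data.List.Relation.Unary.All.Properties using (all-filter; ¬Any⇒All¬; All¬⇒¬Any)
open import Data.List.Relation.Unary.Any as Any using (here; there; any?)
open import Data.List.Relation.Unary.Any.Properties using (lookup-index)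
open import Data.List.Relation.Unary.AllPairs using ([]; _∷_)
open import Data.List.Relation.Unary.Unique.Propositional using (Unique)
open import Data.List.Relation.Unary.Unique.Propositional.Properties using (filter⁺)
open import Data.List.Membership.Propositional.Properties using (∈-filter⁻)
open import Data.Product using (∃-syntax; _×_; _,_; proj₁; proj₂; uncurry)
import Data.Product as Product
open import Data.Product.Properties using (≡-dec)
open import Data.Sum using (_⊎_; inj₁; inj₂; [_,_]′)
import Data.Sum as Sum
open import Function using (id; _∘_)
open import Relation.Binary.Construct.Closure.ReflexiveTransitive using (Star; ε; _◅_)
open import Relation.Nullary using (¬_; Dec; yes; no)
open import Relation.Nullary.Decidable using (⌊_⌋; _⊎-dec_; decidable-stable)
open import Relation.Unary.Properties using (∁?)
open import Relation.Binary.PropositionalEquality as ≡ using (_≡_; _≢_; refl; subst; cong)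
import Data.List.Membership.DecPropositional as DecMembership
open module ListMembership {n} = DecMembership (_≟_ {n})
  using () renaming (_∈_ to _∈ₗ_; _∈?_ to _∈ₗ?_)

private
  variable
    n m : ℕ
    u v w : Fin n
    S S′ : Subset n
    G H : SimpleGraph n
    M N : List (Fin n × Fin n)
    xs : List (Fin n)

-- Subsets and lists of vertices

∣p∪q∣≤∣p∣+∣q∣ : ∀ (p q : Subset n) → ∣ p ∪ q ∣ ≤ ∣ p ∣ + ∣ q ∣
∣p∪q∣≤∣p∣+∣q∣ []            []            = z≤n
∣p∪q∣≤∣p∣+∣q∣ (inside  ∷ p) (s ∷ q)       =
  s≤s (≤-trans (∣p∪q∣≤∣p∣+∣q∣ p q) (+-monoʳ-≤ ∣ p ∣ (∣p∣≤∣x∷p∣ s q)))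
∣p∪q∣≤∣p∣+∣q∣ (outside ∷ p) (inside  ∷ q) =
  ≤-trans (s≤s (∣p∪q∣≤∣p∣+∣q∣ p q)) (≤-reflexive (≡.sym (+-suc ∣ p ∣ ∣ q ∣)))
∣p∪q∣≤∣p∣+∣q∣ (outside ∷ p) (outside ∷ q) = ∣p∪q∣≤∣p∣+∣q∣ p q

∣p∣≤1+∣p-x∣ : ∀ (p : Subset n) x → ∣ p ∣ ≤ suc ∣ p - x ∣
∣p∣≤1+∣p-x∣ p x = begin
  ∣ p ∣                   ≤⟨ p⊆q⇒∣p∣≤∣q∣ p⊆[p-x]∪x ⟩
  ∣ (p - x) ∪ ⁅ x ⁆ ∣     ≤⟨ ∣p∪q∣≤∣p∣+∣q∣ (p - x) ⁅ x ⁆ ⟩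
  ∣ p - x ∣ + ∣ ⁅ x ⁆ ∣   ≡⟨ cong (∣ p - x ∣ +_) (∣⁅x⁆∣≡1 x) ⟩
  ∣ p - x ∣ + 1           ≡⟨ +-comm ∣ p - x ∣ 1 ⟩
  suc ∣ p - x ∣           ∎
  where
  open ≤-Reasoning
  p⊆[p-x]∪x : p ⊆ (p - x) ∪ ⁅ x ⁆
  p⊆[p-x]∪x {y} y∈p with y ≟ x
  ... | yes refl = x∈p∪q⁺ (inj₂ (x∈⁅x⁆ x))
  ... | no  y≢x  = x∈p∪q⁺ (inj₁ (x∈p∧x≢y⇒x∈p-y y∈p y≢x))

-- If x ∈ p - x, removing x once more would shrink p - x, yet p - x - x = p - x.
x∉p-x : ∀ (p : Subset n) x → x ∉ p - x
x∉p-x p x x∈p-x =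
  n≮n _ (subst (λ q → ∣ q ∣ < ∣ p - x ∣) (p─q─q≡p─q p ⁅ x ⁆) (x∈p⇒∣p-x∣<∣p∣ x∈p-x))

unique⊆⇒length≤∣∣ : ∀ {p : Subset n} → Unique xs → All (_∈ p) xs → length xs ≤ ∣ p ∣
unique⊆⇒length≤∣∣ []             []             = z≤n
unique⊆⇒length≤∣∣ (x∉xs ∷ xs-unique) (x∈p ∷ xs⊆p) =
  ≤-trans (s≤s (unique⊆⇒length≤∣∣ xs-unique xs⊆p-x)) (x∈p⇒∣p-x∣<∣p∣ x∈p)
  where
  xs⊆p-x = All.zipWith (λ (y∈p , x≢y) → x∈p∧x≢y⇒x∈p-y y∈p (x≢y ∘ ≡.sym)) (xs⊆p , x∉xs)

unique⇒length≤n : ∀ {n} {xs : List (Fin n)} → Unique xs → length xs ≤ n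
unique⇒length≤n {xs = xs} xs-unique =
  subst (length xs ≤_) (∣⊤∣≡n _) (unique⊆⇒length≤∣∣ xs-unique (All.universal (λ _ → ∈⊤) _))

unique-disjoint⇒length+∣∣≤n : ∀ {n} {xs : List (Fin n)} {S : Subset n} →
                              Unique xs → All (_∉ S) xs → length xs + ∣ S ∣ ≤ n
unique-disjoint⇒length+∣∣≤n {xs = xs} {S} xs-unique xs∉S =
  m≤o∸n⇒m+n≤o _ (∣p∣≤n S)
    (subst (length xs ≤_) (∣∁p∣≡n∸∣p∣ S) (unique⊆⇒length≤∣∣ xs-unique (All.map x∉p⇒x∈∁p xs∉S)))

-- The position of each vertex in xs is an injection Fin n → Fin (length xs).
covering⇒n≤length : ∀ {n} {xs : List (Fin n)} → (∀ w → w ∈ₗ xs) → n ≤ length xs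
covering⇒n≤length {n} {xs} covers with n ≤? length xs
... | yes n≤∣xs∣ = n≤∣xs∣
... | no  n≰∣xs∣ with i , j , i<j , same ← pigeonhole (≰⇒> n≰∣xs∣) (Any.index ∘ covers) =
  ⊥-elim (<⇒≢ i<j (begin
    i                               ≡⟨ lookup-index (covers i) ⟩
    lookup xs (Any.index (covers i)) ≡⟨ cong (lookup xs) same ⟩
    lookup xs (Any.index (covers j)) ≡⟨ lookup-index (covers j) ⟨
    j                               ∎))
  where open ≡.≡-Reasoning

-- Edges and edge deletion

Edge⇒≢ : Edge G u v → u ≢ v
Edge⇒≢ {G = G} {u} uv refl = subst T (irrefl G u) uv

Edge-sym : Edge G u v → Edge G v u
Edge-sym {G = G} {u} {v} = subst T (sym G u v)

star-first-step : ∀ {A : Set} {R : A → A → Set} {x y} → Star R x y → x ≢ y → ∃[ z ] R x z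
star-first-step ε        x≢x = ⊥-elim (x≢x refl)
star-first-step (r ◅ _) _   = _ , r

IsGraph⇒neighbour : IsGraph G → ∀ w → ∃[ x ] Edge G w x
IsGraph⇒neighbour {G = G} (connected , u , v , uv) w with w ≟ u
... | no  w≢u  = star-first-step (connected w u) w≢u
... | yes refl = star-first-step (connected w v) (Edge⇒≢ {G = G} uv)

_≟ₚ_ : ∀ (p q : Fin n × Fin n) → Dec (p ≡ q)
_≟ₚ_ = ≡-dec _≟_ _≟_

T-⌊≟⌋∧⌊≟⌋ : ∀ {x x′ y y′ : Fin n} (x? : Dec (x ≡ x′)) (y? : Dec (y ≡ y′)) →
             T (⌊ x? ⌋ ∧ ⌊ y? ⌋) → (x , y) ≡ (x′ , y′)
T-⌊≟⌋∧⌊≟⌋ (yes refl) (yes refl) _  = refl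
T-⌊≟⌋∧⌊≟⌋ (yes _)    (no _)     ()
T-⌊≟⌋∧⌊≟⌋ (no _)     _          ()

isEdgeAB⇒≡ : ∀ {a b p q : Fin n} → T (isEdgeAB a b p q) → (p , q) ≡ (a , b) ⊎ (p , q) ≡ (b , a)
isEdgeAB⇒≡ {a = a} {b} {p} {q} pq≡ab with p ≟ a | q ≟ b
... | yes refl | yes refl = inj₁ refl
... | yes _    | no  _    = inj₂ (T-⌊≟⌋∧⌊≟⌋ (p ≟ b) (q ≟ a) pq≡ab)
... | no  _    | _        = inj₂ (T-⌊≟⌋∧⌊≟⌋ (p ≟ b) (q ≟ a) pq≡ab)

Edge-─⁺ : ∀ {a b p q : Fin n} → Edge G p q → ¬ ((p , q) ≡ (a , b) ⊎ (p , q) ≡ (b , a)) →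
          Edge (G ─ (a , b)) p q
Edge-─⁺ {G = G} {a = a} {b} {p} {q} pq pq≢ab with isEdgeAB a b p q in ab≡pq
... | true  = ⊥-elim (pq≢ab (isEdgeAB⇒≡ (subst T (≡.sym ab≡pq) tt)))
... | false = subst T (≡.sym (∧-identityʳ (adj G p q))) pq

stable-⊆ : S ⊆ S′ → Stable H S′ → Stable H S
stable-⊆ S⊆S′ stable u v u∈S v∈S = stable u v (S⊆S′ u∈S) (S⊆S′ v∈S)

stable-─ : ∀ {a b : Fin n} → Stable (G ─ (a , b)) S → a ∉ S ⊎ b ∉ S → Stable G S
stable-─ {G = G} {a = a} {b} stable a∉⊎b∉ p q p∈S q∈S pq with (p , q) ≟ₚ (a , b) | (p , q) ≟ₚ (b , a)
... | yes refl | _        = [ (λ a∉S → a∉S p∈S) , (λ b∉S → b∉S q∈S) ]′ a∉⊎b∉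
... | _        | yes refl = [ (λ a∉S → a∉S q∈S) , (λ b∉S → b∉S p∈S) ]′ a∉⊎b∉
... | no pq≢ab | no pq≢ba = stable p q p∈S q∈S (Edge-─⁺ {G = G} pq [ pq≢ab , pq≢ba ]′)

-- Matchings

EdgeIn? : ∀ (N : List (Fin n × Fin n)) u v → Dec (EdgeIn N u v)
EdgeIn? N u v = any? (λ p → (p ≟ₚ (u , v)) ⊎-dec (p ≟ₚ (v , u))) N

EdgeIn-sym : EdgeIn N u v → EdgeIn N v u
EdgeIn-sym = Any.map Sum.swap

lookup-EdgeIn : ∀ {P : Fin n → Fin n → Set} → All (uncurry P) N → EdgeIn N u v → P u v ⊎ P v u
lookup-EdgeIn (Puv ∷ _)  (here (inj₁ refl)) = inj₁ Puv
lookup-EdgeIn (Pvu ∷ _)  (here (inj₂ refl)) = inj₂ Pvu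
lookup-EdgeIn (_   ∷ Ps) (there uv∈N)       = lookup-EdgeIn Ps uv∈N

EdgeIn⇒Edge : IsMatching G N → EdgeIn N u v → Edge G u v
EdgeIn⇒Edge {G = G} (edges , _) uv∈N = [ id , Edge-sym {G = G} ]′ (lookup-EdgeIn edges uv∈N)

EdgeIn⇒∈endpoints : EdgeIn N u v → u ∈ₗ endpoints N
EdgeIn⇒∈endpoints (here (inj₁ refl)) = here refl
EdgeIn⇒∈endpoints (here (inj₂ refl)) = there (here refl)
EdgeIn⇒∈endpoints (there uv∈N)       = there (there (EdgeIn⇒∈endpoints uv∈N))

∈endpoints⇒EdgeIn : u ∈ₗ endpoints N → ∃[ v ] EdgeIn N u v
∈endpoints⇒EdgeIn {N = (_ , q) ∷ _} (here refl)         = q , here (inj₁ refl)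
∈endpoints⇒EdgeIn {N = (p , _) ∷ _} (there (here refl)) = p , here (inj₂ refl)
∈endpoints⇒EdgeIn {N = _ ∷ _}       (there (there u∈N)) = Product.map₂ there (∈endpoints⇒EdgeIn u∈N)

private
  head-unshared : ∀ {p q : Fin n} {ys} → All (p ≢_) (q ∷ ys) → All (q ≢_) ys →
                  (p , q) ≡ (u , v) ⊎ (p , q) ≡ (v , u) → ¬ u ∈ₗ ys
  head-unshared p∉ _  (inj₁ refl) = All¬⇒¬Any (All.tail p∉)
  head-unshared _  q∉ (inj₂ refl) = All¬⇒¬Any q∉

matching-partner-unique : Unique (endpoints N) → EdgeIn N u v → EdgeIn N u w → v ≡ w
matching-partner-unique _ (here (inj₁ refl)) (here (inj₁ refl)) = refl
matching-partner-unique _ (here (inj₁ refl)) (here (inj₂ refl)) = refl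
matching-partner-unique _ (here (inj₂ refl)) (here (inj₁ refl)) = refl
matching-partner-unique _ (here (inj₂ refl)) (here (inj₂ refl)) = refl
matching-partner-unique (p∉ ∷ q∉ ∷ _) (here uv≡) (there uw∈N) =
  ⊥-elim (head-unshared p∉ q∉ uv≡ (EdgeIn⇒∈endpoints uw∈N))
matching-partner-unique (p∉ ∷ q∉ ∷ _) (there uv∈N) (here uw≡) =
  ⊥-elim (head-unshared p∉ q∉ uw≡ (EdgeIn⇒∈endpoints uv∈N))
matching-partner-unique (_ ∷ _ ∷ U) (there uv∈N) (there uw∈N) = matching-partner-unique U uv∈N uw∈N

matching-─ : ∀ {a b : Fin n} → IsMatching G N → ¬ EdgeIn N a b → IsMatching (G ─ (a , b)) N
matching-─ {G = G} {a = a} {b} (edges , unique) ab∉N = edges-─ edges ab∉N , unique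
  where
  edges-─ : ∀ {N} → All (uncurry (Edge G)) N → ¬ EdgeIn N a b → All (uncurry (Edge (G ─ (a , b)))) N
  edges-─ []       _    = []
  edges-─ (e ∷ es) ab∉N = Edge-─⁺ {G = G} e (ab∉N ∘ here) ∷ edges-─ es (ab∉N ∘ there)

maximal⇒covers-endpoint : IsMaximalMatching G M → Edge G u v → u ∈ₗ endpoints M ⊎ v ∈ₗ endpoints M
maximal⇒covers-endpoint {G = G} {M = M} {u} {v} ((edges , unique) , maximal) uv
  with u ∈ₗ? endpoints M | v ∈ₗ? endpoints M
... | yes u∈M | _       = inj₁ u∈M
... | no  _   | yes v∈M = inj₂ v∈M
... | no  u∉M | no  v∉M = ⊥-elim (maximal u v uv
      (uv ∷ edges , (Edge⇒≢ {G = G} uv ∷ ¬Any⇒All¬ _ u∉M) ∷ ¬Any⇒All¬ _ v∉M ∷ unique))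

-- Maximality forces every edge of N to share, hence be, an edge of M.
maximal-⊆⇒⊇ : IsMaximalMatching G M → IsMatching G N →
              (∀ {u v} → EdgeIn M u v → EdgeIn N u v) → EdgeIn N u v → EdgeIn M u v
maximal-⊆⇒⊇ {G = G} {M = M} {N = N} maximal matN@(_ , unique) M⊆N uv∈N =
  [ (λ u∈M → partner-in-M u∈M uv∈N) , (λ v∈M → EdgeIn-sym (partner-in-M v∈M (EdgeIn-sym uv∈N))) ]′
    (maximal⇒covers-endpoint {G = G} maximal (EdgeIn⇒Edge {G = G} matN uv∈N))
  where
  partner-in-M : ∀ {x y} → x ∈ₗ endpoints M → EdgeIn N x y → EdgeIn M x y
  partner-in-M x∈M xy∈N with z , xz∈M ← ∈endpoints⇒EdgeIn x∈M =
    subst (EdgeIn M _) (matching-partner-unique unique (M⊆N xz∈M) xy∈N) xz∈M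

length-endpoints : ∀ (N : List (Fin n × Fin n)) → length (endpoints N) ≡ 2 * length N
length-endpoints []      = refl
length-endpoints (_ ∷ N) =
  ≡.trans (cong (2 +_) (length-endpoints N)) (≡.sym (*-distribˡ-+ 2 1 (length N)))

perfect⇒maximum : IsPerfectMatching G M → IsMatching G N → length N ≤ length M
perfect⇒maximum {M = M} {N = N} (_ , covers) (_ , unique) = *-cancelˡ-≤ 2 (begin
  2 * length N          ≡⟨ length-endpoints N ⟨
  length (endpoints N)  ≤⟨ unique⇒length≤n unique ⟩
  _                     ≤⟨ covering⇒n≤length covers ⟩
  length (endpoints M)  ≡⟨ length-endpoints M ⟩
  2 * length M          ∎)
  where open ≤-Reasoning

-- Matchings and stable sets

endpointsOutside : Subset n → List (Fin n × Fin n) → List (Fin n)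
endpointsOutside S N = filter (∁? (_∈? S)) (endpoints N)

NotWithin : Subset n → Fin n × Fin n → Set
NotWithin S (p , q) = ¬ (p ∈ S × q ∈ S)

private
  endpointsOutside-∷ : ∀ N → NotWithin S (u , v) →
                       suc (length (endpointsOutside S N)) ≤ length (endpointsOutside S ((u , v) ∷ N))
  endpointsOutside-∷ {S = S} {u = u} {v} N uv⊈S with u ∈? S
  ... | yes u∈S with v ∈? S
  ...   | yes v∈S = ⊥-elim (uv⊈S (u∈S , v∈S))
  ...   | no  _   = ≤-refl
  endpointsOutside-∷ {S = S} {u = u} {v} N uv⊈S | no _ with v ∈? S
  ...   | yes _   = ≤-refl
  ...   | no  _   = n≤1+n _

  endpointsOutside-∷-both : ∀ N → u ∉ S → v ∉ S →
                            2 + length (endpointsOutside S N) ≤ length (endpointsOutside S ((u , v) ∷ N))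
  endpointsOutside-∷-both {u = u} {S = S} {v = v} N u∉S v∉S with u ∈? S
  ... | yes u∈S = ⊥-elim (u∉S u∈S)
  ... | no  _   with v ∈? S
  ...   | yes v∈S = ⊥-elim (v∉S v∈S)
  ...   | no  _   = ≤-refl

length≤endpointsOutside : All (NotWithin S) N → length N ≤ length (endpointsOutside S N)
length≤endpointsOutside []           = z≤n
length≤endpointsOutside {N = _ ∷ N} (e⊈S ∷ N⊈S) =
  ≤-trans (s≤s (length≤endpointsOutside N⊈S)) (endpointsOutside-∷ N e⊈S)

length<endpointsOutside : All (NotWithin S) N → EdgeIn N u v → u ∉ S → v ∉ S →
                          length N < length (endpointsOutside S N)
length<endpointsOutside {N = _ ∷ N} (_ ∷ N⊈S) (here (inj₁ refl)) u∉S v∉S =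
  ≤-trans (s≤s (s≤s (length≤endpointsOutside N⊈S))) (endpointsOutside-∷-both N u∉S v∉S)
length<endpointsOutside {N = _ ∷ N} (_ ∷ N⊈S) (here (inj₂ refl)) u∉S v∉S =
  ≤-trans (s≤s (s≤s (length≤endpointsOutside N⊈S))) (endpointsOutside-∷-both N v∉S u∉S)
length<endpointsOutside {N = _ ∷ N} (e⊈S ∷ N⊈S) (there uv∈N) u∉S v∉S =
  ≤-trans (s≤s (length<endpointsOutside N⊈S uv∈N u∉S v∉S)) (endpointsOutside-∷ N e⊈S)

stable⇒NotWithin : Stable H S → All (uncurry (Edge H)) N → All (NotWithin S) N
stable⇒NotWithin stable = All.map (λ pq (p∈S , q∈S) → stable _ _ p∈S q∈S pq)

module _ {n} {H : SimpleGraph n} {N} {S : Subset n} (matching : IsMatching H N) (stable : Stable H S) where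

  private
    N⊈S : All (NotWithin S) N
    N⊈S = stable⇒NotWithin {H = H} stable (proj₁ matching)

    outside-bound : length (endpointsOutside S N) + ∣ S ∣ ≤ n
    outside-bound = unique-disjoint⇒length+∣∣≤n {S = S} (filter⁺ (∁? (_∈? S)) (proj₂ matching))
                                                        (all-filter (∁? (_∈? S)) (endpoints N))

  matching+stable≤n : length N + ∣ S ∣ ≤ n
  matching+stable≤n = ≤-trans (+-monoˡ-≤ ∣ S ∣ (length≤endpointsOutside N⊈S)) outside-bound

  matching+stable<n-of-edge-outside : EdgeIn N u v → u ∉ S → v ∉ S → length N + ∣ S ∣ < n
  matching+stable<n-of-edge-outside uv∈N u∉S v∉S =
    ≤-trans (+-monoˡ-≤ ∣ S ∣ (length<endpointsOutside N⊈S uv∈N u∉S v∉S)) outside-bound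

  matching+stable<n-of-uncovered-outside : w ∉ S → ¬ w ∈ₗ endpoints N → length N + ∣ S ∣ < n
  matching+stable<n-of-uncovered-outside {w} w∉S w∉N =
    ≤-trans (s≤s (+-monoˡ-≤ ∣ S ∣ (length≤endpointsOutside N⊈S)))
            (unique-disjoint⇒length+∣∣≤n {S = S} (w-fresh ∷ filter⁺ (∁? (_∈? S)) (proj₂ matching))
                                         (w∉S ∷ all-filter (∁? (_∈? S)) (endpoints N)))
    where
    w-fresh = ¬Any⇒All¬ (endpointsOutside S N) (w∉N ∘ proj₁ ∘ ∈-filter⁻ (∁? (_∈? S)))

-- Critical edges

module StabilityNumber {n} {G : SimpleGraph n} {a} (α : IsAlpha G a) where

  ∣stable∣≤α : ∀ {S} → Stable G S → ∣ S ∣ ≤ a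
  ∣stable∣≤α stable = let _ , (_ , maximum) , ∣S₀∣≡a = α in subst (_ ≤_) ∣S₀∣≡a (maximum _ stable)

  α≤∣maxStable∣ : ∀ {S} → MaxStable G S → a ≤ ∣ S ∣
  α≤∣maxStable∣ (_ , maximum) =
    let S₀ , (stable₀ , _) , ∣S₀∣≡a = α in subst (_≤ _) ∣S₀∣≡a (maximum S₀ stable₀)

  maxStable⁺ : ∀ {S} → Stable G S → a ≤ ∣ S ∣ → MaxStable G S
  maxStable⁺ stable a≤∣S∣ = stable , λ T stableT → ≤-trans (∣stable∣≤α stableT) a≤∣S∣

  α-critical⇒large-stable : ∀ {u v} → AlphaCritical G u v → ∃[ T ] (Stable (G ─ (u , v)) T × a < ∣ T ∣)
  α-critical⇒large-stable (_ , a₀ , a′ , (S₁ , maxS₁ , ∣S₁∣≡a₀) , (T , (stableT , _) , ∣T∣≡a′) , a₀<a′) =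
    T , stableT , (begin-strict
      a      ≤⟨ α≤∣maxStable∣ maxS₁ ⟩
      ∣ S₁ ∣ ≡⟨ ∣S₁∣≡a₀ ⟩
      a₀     <⟨ a₀<a′ ⟩
      a′     ≡⟨ ∣T∣≡a′ ⟨
      ∣ T ∣  ∎)
    where open ≤-Reasoning

  module _ {u v T} (stableT : Stable (G ─ (u , v)) T) (a<∣T∣ : a < ∣ T ∣) where

    large-stable-of-─∋endpoints : u ∈ T × v ∈ T
    large-stable-of-─∋endpoints = decidable-stable (u ∈? T) (T-not-stable-in-G ∘ inj₁)
                                , decidable-stable (v ∈? T) (T-not-stable-in-G ∘ inj₂)
      where
      T-not-stable-in-G : ¬ (u ∉ T ⊎ v ∉ T)
      T-not-stable-in-G missing = <⇒≱ a<∣T∣ (∣stable∣≤α (stable-─ {G = G} stableT missing))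

    minus-endpoint⇒maxStable : ∀ {y} → u ∉ T - y ⊎ v ∉ T - y → MaxStable G (T - y)
    minus-endpoint⇒maxStable {y} missing =
      maxStable⁺ (stable-─ {G = G} (stable-⊆ {H = G ─ (u , v)} (p─q⊆p T ⁅ y ⁆) stableT) missing)
                 (≤-pred (≤-trans a<∣T∣ (∣p∣≤1+∣p-x∣ T y)))

  α-critical⇒endpoints∈maxStable : ∀ {u v} → AlphaCritical G u v →
    (∃[ S ] MaxStable G S × u ∈ S) × (∃[ S ] MaxStable G S × v ∈ S)
  α-critical⇒endpoints∈maxStable {u} {v} critical@(uv , _)
    with T , stableT , a<∣T∣ ← α-critical⇒large-stable critical =
      (T - v , minus-endpoint⇒maxStable stableT a<∣T∣ (inj₂ (x∉p-x T v)) , x∈p∧x≢y⇒x∈p-y u∈T u≢v)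
    , (T - u , minus-endpoint⇒maxStable stableT a<∣T∣ (inj₁ (x∉p-x T u)) , x∈p∧x≢y⇒x∈p-y v∈T (u≢v ∘ ≡.sym))
    where
    u≢v = Edge⇒≢ {G = G} uv
    u∈T = proj₁ (large-stable-of-─∋endpoints stableT a<∣T∣)
    v∈T = proj₂ (large-stable-of-─∋endpoints stableT a<∣T∣)

InEveryMaximumMatching : SimpleGraph n → ℕ → Fin n → Fin n → Set
InEveryMaximumMatching G m u v = ∀ N → IsMatching G N → m ≤ length N → EdgeIn N u v

μ-critical⇒inEveryMaximumMatching : IsMu G m → MuCritical G u v → InEveryMaximumMatching G m u v
μ-critical⇒inEveryMaximumMatching {G = G} {m = m} {u = u} {v}
  (_ , _ , _ , maximum) (_ , m₀ , m′ , (N₀ , matching₀ , ∣N₀∣≡m₀ , _) , (_ , _ , _ , maximum′) , m′<m₀)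
  N matching m≤∣N∣ with EdgeIn? N u v
... | yes uv∈N = uv∈N
... | no  uv∉N = ⊥-elim (n≮n m′ (begin-strict
      m′         <⟨ m′<m₀ ⟩
      m₀         ≡⟨ ∣N₀∣≡m₀ ⟨
      length N₀  ≤⟨ maximum N₀ matching₀ ⟩
      m          ≤⟨ m≤∣N∣ ⟩
      length N   ≤⟨ maximum′ N (matching-─ {G = G} matching uv∉N) ⟩
      m′         ∎))
  where open ≤-Reasoning

module KönigEgerváry {n} {G : SimpleGraph n} {a m}
                     (α : IsAlpha G a) (μ : IsMu G m) (a+m≡n : a + m ≡ n) where

  open StabilityNumber {G = G} α

  private
    N₀ : List (Fin n × Fin n)
    N₀ = proj₁ μ

    N₀-matching : IsMatching G N₀
    N₀-matching = proj₁ (proj₂ μ)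

    m≤∣N₀∣ : m ≤ length N₀
    m≤∣N₀∣ = ≤-reflexive (≡.sym (proj₁ (proj₂ (proj₂ μ))))

    no-room : ∀ {k l} → m ≤ k → a ≤ l → ¬ (k + l < n)
    no-room {k} {l} m≤k a≤l k+l<n = n≮n (m + a) (begin-strict
      m + a  ≤⟨ +-mono-≤ m≤k a≤l ⟩
      k + l  <⟨ k+l<n ⟩
      n      ≡⟨ a+m≡n ⟨
      a + m  ≡⟨ +-comm a m ⟩
      m + a  ∎)
      where open ≤-Reasoning

  α-critical⇒inEveryMaximumMatching : ∀ {u v} → AlphaCritical G u v → InEveryMaximumMatching G m u v
  α-critical⇒inEveryMaximumMatching {u} {v} critical N matching m≤∣N∣ with EdgeIn? N u v
  ... | yes uv∈N = uv∈N
  ... | no  uv∉N with T , stableT , a<∣T∣ ← α-critical⇒large-stable critical =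
    ⊥-elim (no-room m≤∣N∣ ≤-refl (begin-strict
      length N + a      <⟨ +-monoʳ-< (length N) a<∣T∣ ⟩
      length N + ∣ T ∣  ≤⟨ matching+stable≤n {H = G ─ (u , v)} (matching-─ {G = G} matching uv∉N) stableT ⟩
      n                 ∎))
    where open ≤-Reasoning

  inEveryMaximumMatching⇒exactlyOneEndpoint : ∀ {u v S} → Edge G u v → InEveryMaximumMatching G m u v →
                                              MaxStable G S → ExactlyOneEndpoint S u v
  inEveryMaximumMatching⇒exactlyOneEndpoint {u} {v} {S} uv inEvery maxS@(stableS , _)
    with u ∈? S | v ∈? S
  ... | yes u∈S | yes v∈S = ⊥-elim (stableS u v u∈S v∈S uv)
  ... | yes u∈S | no  v∉S = inj₁ (u∈S , v∉S)
  ... | no  u∉S | yes v∈S = inj₂ (u∉S , v∈S)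
  ... | no  u∉S | no  v∉S = ⊥-elim (no-room m≤∣N₀∣ (α≤∣maxStable∣ maxS)
        (matching+stable<n-of-edge-outside {H = G} N₀-matching stableS
           (inEvery N₀ N₀-matching m≤∣N₀∣) u∉S v∉S))

  uncovered⇒∈maxStable : ∀ {N w S} → IsMatching G N → m ≤ length N → ¬ w ∈ₗ endpoints N →
                         MaxStable G S → w ∈ S
  uncovered⇒∈maxStable {w = w} {S} matching m≤∣N∣ w∉N maxS@(stableS , _) =
    decidable-stable (w ∈? S) λ w∉S →
      no-room m≤∣N∣ (α≤∣maxStable∣ maxS)
        (matching+stable<n-of-uncovered-outside {H = G} matching stableS w∉S w∉N)

  module _ {M} (maximal : IsMaximalMatching G M) (critical : All (uncurry (AlphaCritical G)) M) where

    private
      M⊆maximum : ∀ {N u v} → IsMatching G N → m ≤ length N → EdgeIn M u v → EdgeIn N u v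
      M⊆maximum matN m≤∣N∣ uv∈M =
        [ (λ uv-critical → α-critical⇒inEveryMaximumMatching uv-critical _ matN m≤∣N∣)
        , (λ vu-critical → EdgeIn-sym (α-critical⇒inEveryMaximumMatching vu-critical _ matN m≤∣N∣))
        ]′ (lookup-EdgeIn critical uv∈M)

      uncovered-by-N₀ : ∀ {w} → ¬ w ∈ₗ endpoints M → ¬ w ∈ₗ endpoints N₀
      uncovered-by-N₀ w∉M w∈N₀ with z , wz∈N₀ ← ∈endpoints⇒EdgeIn w∈N₀ =
        w∉M (EdgeIn⇒∈endpoints
              (maximal-⊆⇒⊇ {G = G} maximal N₀-matching (M⊆maximum N₀-matching m≤∣N₀∣) wz∈N₀))

      covered⇒∈maxStable : ∀ {x} → x ∈ₗ endpoints M → ∃[ S ] MaxStable G S × x ∈ S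
      covered⇒∈maxStable x∈M with y , xy∈M ← ∈endpoints⇒EdgeIn x∈M =
        [ proj₁ ∘ α-critical⇒endpoints∈maxStable , proj₂ ∘ α-critical⇒endpoints∈maxStable ]′
          (lookup-EdgeIn critical xy∈M)

    α-critical-maximal⇒perfect : IsGraph G → IsPerfectMatching G M
    α-critical-maximal⇒perfect graph = proj₁ maximal , covers
      where
      uncovered-absurd : ∀ {w} → ¬ w ∈ₗ endpoints M → ¬ (∃[ x ] Edge G w x)
      uncovered-absurd {w} w∉M (x , wx) with maximal⇒covers-endpoint {G = G} maximal wx
      ... | inj₁ w∈M = w∉M w∈M
      ... | inj₂ x∈M with S , maxS@(stableS , _) , x∈S ← covered⇒∈maxStable x∈M =
        stableS w x (uncovered⇒∈maxStable N₀-matching m≤∣N₀∣ (uncovered-by-N₀ w∉M) maxS) x∈S wx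

      covers : ∀ w → w ∈ₗ endpoints M
      covers w = decidable-stable (w ∈ₗ? endpoints M) λ w∉M →
        uncovered-absurd w∉M (IsGraph⇒neighbour {G = G} graph w)

    α-critical-maximal⇒sameEdges-perfect : ∀ M′ → IsPerfectMatching G M′ → SameEdges M M′
    α-critical-maximal⇒sameEdges-perfect M′ perfect′@(matching′ , _) _ _ =
      M⊆maximum matching′ m≤∣M′∣ , maximal-⊆⇒⊇ {G = G} maximal matching′ (M⊆maximum matching′ m≤∣M′∣)
      where
      m≤∣M′∣ = ≤-trans m≤∣N₀∣ (perfect⇒maximum {G = G} perfect′ N₀-matching)

proposition2p10 : ∀ {n} (G : SimpleGraph n) → IsGraph G → KonigEgervary G →
    ((S : _) → MaxStable G S → ∀ u v → MuCritical G u v → ExactlyOneEndpoint S u v)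
    × ((S : _) → MaxStable G S → ∀ u v → AlphaCritical G u v → ExactlyOneEndpoint S u v)
    × ((M : List (Fin n × Fin n)) → IsMaximalMatching G M →
        All (λ { (u , v) → AlphaCritical G u v }) M → IsUniquePerfectMatching G M)
proposition2p10 G graph (_ , _ , α , μ , a+m≡n) =
    (λ S maxS u v μ-critical →
       inEveryMaximumMatching⇒exactlyOneEndpoint (proj₁ μ-critical)
         (μ-critical⇒inEveryMaximumMatching {G = G} μ μ-critical) maxS)
  , (λ S maxS u v α-critical →
       inEveryMaximumMatching⇒exactlyOneEndpoint (proj₁ α-critical)
         (α-critical⇒inEveryMaximumMatching α-critical) maxS)
  , (λ M maximal critical →
       α-critical-maximal⇒perfect maximal critical graph , α-critical-maximal⇒sameEdges-perfect maximal critical)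
  where open KönigEgerváry {G = G} α μ a+m≡n
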